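{- Let $n$ be a power of $2$, let $P=\{C_l : l\in L\}$ be a partition of the set of odd-weight binary vectors of length $n$ into extended perfect codes, let $\pi$ be a permutation of the index set $L$, and let $D_P=\bigcup_{l\in L} C_l\times C_{\pi(l)}$ (a binary code of length $2n$). Let $(X,Y)\in D_P$ with $X\in C_k$, and let $i\neq j$ be coordinates among the first $n$ coordinates. If $X+e_i+e_j\in C_l$, then $$N_{ij}(D_P,(X,Y))=\big(N_{ij}(C_k,X)\times\{Y\}\big)\cup\{(X+e_i+e_j,Z): Z\in C_{\pi(l)},\ d(Z,Y)=2\}.$$
   Context: An extended perfect code of length $n$ is a binary code of length $n$ with minimum distance $4$ and $2^{n}/(2n)$ codewords. $d$ denotes Hamming distance, $e_i$ the $i$-th unit vector. A vector of $D_P$ is a pair $(X,Y)$ whose first $n$ coordinates are those of $X$. For a code $D$ and $X\in D$, $N_{ij}(D,X)$ is the set of codewords of $D$ at distance $4$ from $X$ that differ from $X$ in coordinates $i$ and $j$. -}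

module Defs where

open import Data.Bool using (Bool; true; false; not; _xor_)
open import Data.Nat using (ℕ; zero; suc; _+_; _*_; _^_; _≤_; _%_)
open import Data.Fin using (Fin; _↑ˡ_)
open import Data.Vec using (Vec; []; _∷_; lookup; zipWith; count; _[_]%=_; _++_)
open import Data.List using (List; []; _∷_; map; _++_; filter; length)
open import Data.Product using (Σ; ∃; ∃-syntax; _×_; _,_)
open import Data.Sum using (_⊎_)
open import Relation.Binary.PropositionalEquality using (_≡_; _≢_)
open import Relation.Nullary using (¬_)
open import Function.Bundles using (_↔_; Inverse)

Word : ℕ → Set
Word n = Vec Bool n

Code : ℕ → Set
Code n = Word n → Bool

_∈C_ : ∀ {n} → Word n → Code n → Set
w ∈C c = c w ≡ true

SetCode : ℕ → Set₁
SetCode n = Word n → Set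

asSet : ∀ {n} → Code n → SetCode n
asSet c w = w ∈C c

allWords : (n : ℕ) → List (Word n)
allWords zero = [] ∷ []
allWords (suc n) = Data.List._++_ (map (true ∷_) (allWords n)) (map (false ∷_) (allWords n))

size : ∀ {n} → Code n → ℕ
size {n} c = length (filter (λ w → Data.Bool._≟_ (c w) true) (allWords n))

weight : ∀ {n} → Word n → ℕ
weight w = count (λ b → Data.Bool._≟_ b true) w

dist : ∀ {n} → Word n → Word n → ℕ
dist x y = weight (zipWith _xor_ x y)

OddWeight : ∀ {n} → Word n → Set
OddWeight w = weight w % 2 ≡ 1

addUnit : ∀ {n} → Fin n → Word n → Word n
addUnit i x = x [ i ]%= not

MinDist4 : ∀ {n} → Code n → Set
MinDist4 c = ∀ x y → x ∈C c → y ∈C c → x ≢ y → 4 ≤ dist x y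

IsExtendedPerfect : (n : ℕ) → Code n → Set
IsExtendedPerfect n c = MinDist4 c × size c * (2 * n) ≡ 2 ^ n

IsPowerOf2 : ℕ → Set
IsPowerOf2 n = ∃[ m ] n ≡ 2 ^ m

IsOddPartition : (n : ℕ) → {L : Set} → (L → Code n) → Set
IsOddPartition n {L} C =
  (∀ l → IsExtendedPerfect n (C l)) ×
  (∀ l w → w ∈C C l → OddWeight w) ×
  (∀ w → OddWeight w → ∃[ l ] w ∈C C l) ×
  (∀ l l' w → w ∈C C l → w ∈C C l' → l ≡ l')

-- D_P = ⋃_l C_l × C_{π(l)}, a code of length 2n; (X , Y) is the word X ++ Y
D_P : ∀ {n} {L : Set} → (L → Code n) → (L ↔ L) → SetCode (n + n)
D_P {n} {L} C π w = ∃[ X ] ∃[ Y ] w ≡ X Data.Vec.++ Y × ∃[ l ] (X ∈C C l × Y ∈C C (Inverse.to π l))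

N : ∀ {m} → Fin m → Fin m → SetCode m → Word m → SetCode m
N i j D X W = D W × dist W X ≡ 4 × lookup W i ≢ lookup X i × lookup W j ≢ lookup X j

-- Write a neighbour of (X, Y) as (X', Y'). As X' differs from X at i and j,
-- d(X', X) = 2 + d(X', X + e_i + e_j), so the remaining distance 2 splits between
-- d(X', X + e_i + e_j) and d(Y', Y). All classes consist of odd-weight words, so d(X', X)
-- is even and the split 1 + 1 is impossible. The split 0 + 2 gives X' = X + e_i + e_j ∈ C_l,
-- hence Y' ∈ C_π(l); the split 2 + 0 gives Y' = Y ∈ C_π(k), hence X' ∈ C_k because the
-- classes are disjoint and π is injective.
module Submission where

open import Defs
open import Data.Bool using (true; false; not; _∧_; _xor_)
open import Data.Empty using (⊥-elim)
open import Data.Fin using (Fin; zero; suc; _↑ˡ_)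
open import Data.Nat using (ℕ; suc; _+_; _*_; _%_)
open import Data.Nat.DivMod using (%-distribˡ-+; [m+kn]%n≡m%n)
open import Data.Nat.Properties using (+-suc; suc-injective)
open import Data.Product using (∃-syntax; _×_; _,_)
open import Data.Sum as Sum using (_⊎_; inj₁; inj₂)
open import Data.Vec using ([]; _∷_; lookup; zipWith; _++_)
open import Data.Vec.Properties using (lookup∘updateAt; lookup∘updateAt′; lookup-++ˡ; zipWith-++; ++-injective)
open import Function using (id)
open import Function.Bundles using (_↔_; _⇔_; Inverse; Injection; Equivalence; mk⇔)
open import Function.Properties.Inverse using (↔⇒↣)
open import Relation.Binary.PropositionalEquality using (_≡_; _≢_; ≢-sym; refl; trans; cong; cong₂; subst; module ≡-Reasoning)

open ≡-Reasoning

weight-++ : ∀ {m k} (x : Word m) (y : Word k) → weight (x ++ y) ≡ weight x + weight y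
weight-++ []          y = refl
weight-++ (true ∷ x)  y = cong suc (weight-++ x y)
weight-++ (false ∷ x) y = weight-++ x y

dist-++ : ∀ {m k} (x x' : Word m) (y y' : Word k) → dist (x ++ y) (x' ++ y') ≡ dist x x' + dist y y'
dist-++ x x' y y' = trans (cong weight (zipWith-++ _xor_ x y x' y')) (weight-++ (zipWith _xor_ x x') (zipWith _xor_ y y'))

dist-same : ∀ {m} (x : Word m) → dist x x ≡ 0
dist-same []          = refl
dist-same (true ∷ x)  = dist-same x
dist-same (false ∷ x) = dist-same x

dist≡0⇒≡ : ∀ {m} (x y : Word m) → dist x y ≡ 0 → x ≡ y
dist≡0⇒≡ []          []          _ = refl
dist≡0⇒≡ (true ∷ x)  (true ∷ y)  d = cong (true ∷_) (dist≡0⇒≡ x y d)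
dist≡0⇒≡ (false ∷ x) (false ∷ y) d = cong (false ∷_) (dist≡0⇒≡ x y d)

common : ∀ {m} → Word m → Word m → ℕ
common x y = weight (zipWith _∧_ x y)

weight+weight≡dist+common*2 : ∀ {m} (x y : Word m) → weight x + weight y ≡ dist x y + common x y * 2
weight+weight≡dist+common*2 []          []          = refl
weight+weight≡dist+common*2 (false ∷ x) (false ∷ y) = weight+weight≡dist+common*2 x y
weight+weight≡dist+common*2 (true ∷ x)  (false ∷ y) = cong suc (weight+weight≡dist+common*2 x y)
weight+weight≡dist+common*2 (false ∷ x) (true ∷ y)  =
  trans (+-suc (weight x) (weight y)) (cong suc (weight+weight≡dist+common*2 x y))
weight+weight≡dist+common*2 (true ∷ x)  (true ∷ y)  = begin
  suc (weight x + suc (weight y))       ≡⟨ cong suc (+-suc (weight x) (weight y)) ⟩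
  suc (suc (weight x + weight y))       ≡⟨ cong (λ s → suc (suc s)) (weight+weight≡dist+common*2 x y) ⟩
  suc (suc (dist x y + common x y * 2)) ≡⟨ cong suc (+-suc (dist x y) _) ⟨
  suc (dist x y + suc (common x y * 2)) ≡⟨ +-suc (dist x y) _ ⟨
  dist x y + suc (suc (common x y * 2)) ∎

dist-even : ∀ {m} (x y : Word m) → OddWeight x → OddWeight y → dist x y % 2 ≡ 0
dist-even x y x-odd y-odd = begin
  dist x y % 2                          ≡⟨ [m+kn]%n≡m%n (dist x y) (common x y) 2 ⟨
  (dist x y + common x y * 2) % 2       ≡⟨ cong (_% 2) (weight+weight≡dist+common*2 x y) ⟨
  (weight x + weight y) % 2             ≡⟨ %-distribˡ-+ (weight x) (weight y) 2 ⟩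
  (weight x % 2 + weight y % 2) % 2     ≡⟨ cong₂ (λ a b → (a + b) % 2) x-odd y-odd ⟩
  0                                     ∎

dist-addUnit : ∀ {m} (i : Fin m) (x y : Word m) → lookup x i ≢ lookup y i →
               dist x y ≡ suc (dist x (addUnit i y))
dist-addUnit zero    (true ∷ x)  (true ∷ y)  x≢y = ⊥-elim (x≢y refl)
dist-addUnit zero    (true ∷ x)  (false ∷ y) _   = refl
dist-addUnit zero    (false ∷ x) (true ∷ y)  _   = refl
dist-addUnit zero    (false ∷ x) (false ∷ y) x≢y = ⊥-elim (x≢y refl)
dist-addUnit (suc i) (true ∷ x)  (true ∷ y)  x≢y = dist-addUnit i x y x≢y
dist-addUnit (suc i) (true ∷ x)  (false ∷ y) x≢y = cong suc (dist-addUnit i x y x≢y)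
dist-addUnit (suc i) (false ∷ x) (true ∷ y)  x≢y = cong suc (dist-addUnit i x y x≢y)
dist-addUnit (suc i) (false ∷ x) (false ∷ y) x≢y = dist-addUnit i x y x≢y

addUnits : ∀ {m} → Fin m → Fin m → Word m → Word m
addUnits i j x = addUnit j (addUnit i x)

not-≢ : ∀ b → not b ≢ b
not-≢ true  ()
not-≢ false ()

addUnits-differsˡ : ∀ {m} {i j : Fin m} (x : Word m) → i ≢ j → lookup (addUnits i j x) i ≢ lookup x i
addUnits-differsˡ {i = i} {j} x i≢j eq = not-≢ (lookup x i) (begin
  not (lookup x i)             ≡⟨ lookup∘updateAt i x ⟨
  lookup (addUnit i x) i       ≡⟨ lookup∘updateAt′ i j i≢j (addUnit i x) ⟨
  lookup (addUnits i j x) i    ≡⟨ eq ⟩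
  lookup x i                   ∎)

addUnits-differsʳ : ∀ {m} {i j : Fin m} (x : Word m) → i ≢ j → lookup (addUnits i j x) j ≢ lookup x j
addUnits-differsʳ {i = i} {j} x i≢j eq = not-≢ (lookup x j) (begin
  not (lookup x j)             ≡⟨ cong not (lookup∘updateAt′ j i (≢-sym i≢j) x) ⟨
  not (lookup (addUnit i x) j) ≡⟨ lookup∘updateAt j (addUnit i x) ⟨
  lookup (addUnits i j x) j    ≡⟨ eq ⟩
  lookup x j                   ∎)

dist-addUnits : ∀ {m} {i j : Fin m} (x y : Word m) → i ≢ j →
                lookup x i ≢ lookup y i → lookup x j ≢ lookup y j →
                dist x y ≡ 2 + dist x (addUnits i j y)
dist-addUnits {i = i} {j} x y i≢j xᵢ≢yᵢ xⱼ≢yⱼ =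
  trans (dist-addUnit i x y xᵢ≢yᵢ) (cong suc (dist-addUnit j x (addUnit i y) xⱼ≢y⁺ⱼ))
  where
  xⱼ≢y⁺ⱼ : lookup x j ≢ lookup (addUnit i y) j
  xⱼ≢y⁺ⱼ eq = xⱼ≢yⱼ (trans eq (lookup∘updateAt′ j i (≢-sym i≢j) y))

dist-addUnits-self : ∀ {m} {i j : Fin m} (x : Word m) → i ≢ j → dist (addUnits i j x) x ≡ 2
dist-addUnits-self {i = i} {j} x i≢j = begin
  dist (addUnits i j x) x                         ≡⟨ dist-addUnits (addUnits i j x) x i≢j
                                                       (addUnits-differsˡ x i≢j) (addUnits-differsʳ x i≢j) ⟩
  2 + dist (addUnits i j x) (addUnits i j x)      ≡⟨ cong (2 +_) (dist-same (addUnits i j x)) ⟩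
  2                                               ∎

lookup-++ˡ-≢ : ∀ {m k} (x x' : Word m) (y y' : Word k) (i : Fin m) →
               (lookup (x ++ y) (i ↑ˡ k) ≢ lookup (x' ++ y') (i ↑ˡ k)) ⇔ (lookup x i ≢ lookup x' i)
lookup-++ˡ-≢ x x' y y' i rewrite lookup-++ˡ x y i | lookup-++ˡ x' y' i = mk⇔ id id

m+n≡2∧m≢1⇒ : ∀ m n → m + n ≡ 2 → m ≢ 1 → (m ≡ 0 × n ≡ 2) ⊎ (m ≡ 2 × n ≡ 0)
m+n≡2∧m≢1⇒ 0 n m+n≡2 _ = inj₁ (refl , m+n≡2)
m+n≡2∧m≢1⇒ 1 n _ m≢1 = ⊥-elim (m≢1 refl)
m+n≡2∧m≢1⇒ 2 n m+n≡2 _ = inj₂ (refl , suc-injective (suc-injective m+n≡2))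
m+n≡2∧m≢1⇒ (suc (suc (suc m))) n ()

++-neighbour-split : ∀ {m} {i j : Fin m} (x' x y' y : Word m) → i ≢ j → OddWeight x' → OddWeight x →
                     dist (x' ++ y') (x ++ y) ≡ 4 → lookup x' i ≢ lookup x i → lookup x' j ≢ lookup x j →
                     (x' ≡ addUnits i j x × dist y' y ≡ 2) ⊎ (dist x' x ≡ 4 × y' ≡ y)
++-neighbour-split {i = i} {j} x' x y' y i≢j x'-odd x-odd d≡4 xᵢ≢ xⱼ≢ =
  Sum.map (λ (d⁺≡0 , d≡2) → dist≡0⇒≡ x' (addUnits i j x) d⁺≡0 , d≡2)
          (λ (d⁺≡2 , d≡0) → trans d≡2+d⁺ (cong (2 +_) d⁺≡2) , dist≡0⇒≡ y' y d≡0)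
          (m+n≡2∧m≢1⇒ (dist x' (addUnits i j x)) (dist y' y) halves≡2 d⁺≢1)
  where
  d≡2+d⁺ : dist x' x ≡ 2 + dist x' (addUnits i j x)
  d≡2+d⁺ = dist-addUnits x' x i≢j xᵢ≢ xⱼ≢
  halves≡2 : dist x' (addUnits i j x) + dist y' y ≡ 2
  halves≡2 = suc-injective (suc-injective (begin
    2 + dist x' (addUnits i j x) + dist y' y ≡⟨ cong (_+ dist y' y) d≡2+d⁺ ⟨
    dist x' x + dist y' y                    ≡⟨ dist-++ x' x y' y ⟨
    dist (x' ++ y') (x ++ y)                 ≡⟨ d≡4 ⟩
    4                                        ∎))
  d⁺≢1 : dist x' (addUnits i j x) ≢ 1
  d⁺≢1 d⁺≡1 with subst (λ d → d % 2 ≡ 0) (trans d≡2+d⁺ (cong (2 +_) d⁺≡1)) (dist-even x' x x'-odd x-odd)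
  ... | ()

PairwiseDisjoint : ∀ {n} {L : Set} → (L → Code n) → Set
PairwiseDisjoint {L = L} C = ∀ (l l' : L) w → w ∈C C l → w ∈C C l' → l ≡ l'

PairwiseDisjoint-reindex : ∀ {n} {L : Set} {C : L → Code n} → PairwiseDisjoint C →
                           (π : L ↔ L) → PairwiseDisjoint (λ l → C (Inverse.to π l))
PairwiseDisjoint-reindex disjoint π _ _ w w∈ w∈' = Injection.injective (↔⇒↣ π) (disjoint _ _ w w∈ w∈')

∈D_P⇒∈C : ∀ {n} {L : Set} {C : L → Code n} → PairwiseDisjoint C → (π : L ↔ L) →
          ∀ {X Y k} → D_P C π (X ++ Y) → X ∈C C k → Y ∈C C (Inverse.to π k)
∈D_P⇒∈C {C = C} disjoint π {X} {Y} {k} (X₀ , Y₀ , XY≡X₀Y₀ , m , X₀∈ , Y₀∈) X∈ with ++-injective X X₀ XY≡X₀Y₀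
... | refl , refl = subst (λ c → Y ∈C C (Inverse.to π c)) (disjoint m k X X₀∈ X∈) Y₀∈

module Neighbourhood {n} {L : Set} (C : L → Code n) (π : L ↔ L)
  (oddWeight : ∀ l w → w ∈C C l → OddWeight w) (disjoint : PairwiseDisjoint C)
  {X Y : Word n} {k : L} (X∈Cₖ : X ∈C C k) (Y∈Cπₖ : Y ∈C C (Inverse.to π k))
  {i j : Fin n} (i≢j : i ≢ j) {l : L} (X⁺∈Cₗ : addUnits i j X ∈C C l) where

  N-⊆ : ∀ {W} → N (i ↑ˡ n) (j ↑ˡ n) (D_P C π) (X ++ Y) W →
        (∃[ X' ] (N i j (asSet (C k)) X X' × W ≡ X' ++ Y)) ⊎
        (∃[ Z ] (Z ∈C C (Inverse.to π l) × dist Z Y ≡ 2 × W ≡ addUnits i j X ++ Z))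
  N-⊆ ((X' , Y' , refl , m , X'∈Cₘ , Y'∈Cπₘ) , d≡4 , ≢ᵢ , ≢ⱼ)
    with ++-neighbour-split X' X Y' Y i≢j (oddWeight m X' X'∈Cₘ) (oddWeight k X X∈Cₖ) d≡4 xᵢ≢ xⱼ≢
    where
    xᵢ≢ : lookup X' i ≢ lookup X i
    xᵢ≢ = Equivalence.to (lookup-++ˡ-≢ X' X Y' Y i) ≢ᵢ
    xⱼ≢ : lookup X' j ≢ lookup X j
    xⱼ≢ = Equivalence.to (lookup-++ˡ-≢ X' X Y' Y j) ≢ⱼ
  ... | inj₁ (refl , d≡2) =
    inj₂ (Y' , subst (λ c → Y' ∈C C (Inverse.to π c)) (disjoint m l X' X'∈Cₘ X⁺∈Cₗ) Y'∈Cπₘ , d≡2 , refl)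
  ... | inj₂ (d≡4′ , refl) =
    inj₁ (X' , (X'∈Cₖ , d≡4′ , Equivalence.to (lookup-++ˡ-≢ X' X Y Y i) ≢ᵢ , Equivalence.to (lookup-++ˡ-≢ X' X Y Y j) ≢ⱼ) , refl)
    where
    X'∈Cₖ : X' ∈C C k
    X'∈Cₖ = subst (λ c → X' ∈C C c) (PairwiseDisjoint-reindex disjoint π m k Y Y'∈Cπₘ Y∈Cπₖ) X'∈Cₘ

  N-⊇ : ∀ {W} → (∃[ X' ] (N i j (asSet (C k)) X X' × W ≡ X' ++ Y)) ⊎
                (∃[ Z ] (Z ∈C C (Inverse.to π l) × dist Z Y ≡ 2 × W ≡ addUnits i j X ++ Z)) →
        N (i ↑ˡ n) (j ↑ˡ n) (D_P C π) (X ++ Y) W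
  N-⊇ (inj₁ (X' , (X'∈Cₖ , d≡4 , X'ᵢ≢ , X'ⱼ≢) , refl)) =
    (X' , Y , refl , k , X'∈Cₖ , Y∈Cπₖ) ,
    trans (dist-++ X' X Y Y) (cong₂ _+_ d≡4 (dist-same Y)) ,
    Equivalence.from (lookup-++ˡ-≢ X' X Y Y i) X'ᵢ≢ ,
    Equivalence.from (lookup-++ˡ-≢ X' X Y Y j) X'ⱼ≢
  N-⊇ (inj₂ (Z , Z∈Cπₗ , d≡2 , refl)) =
    (addUnits i j X , Z , refl , l , X⁺∈Cₗ , Z∈Cπₗ) ,
    trans (dist-++ (addUnits i j X) X Z Y) (cong₂ _+_ (dist-addUnits-self X i≢j) d≡2) ,
    Equivalence.from (lookup-++ˡ-≢ (addUnits i j X) X Z Y i) (addUnits-differsˡ X i≢j) ,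
    Equivalence.from (lookup-++ˡ-≢ (addUnits i j X) X Z Y j) (addUnits-differsʳ X i≢j)

mainTheorem2 : (n : ℕ) → IsPowerOf2 n →
    (L : Set) (C : L → Code n) → IsOddPartition n C →
    (π : L ↔ L) →
    (X Y : Word n) → D_P C π (X ++ Y) →
    (k : L) → X ∈C C k →
    (i j : Fin n) → i ≢ j →
    (l : L) → addUnit j (addUnit i X) ∈C C l →
    (W : Word (n + n)) →
      (N (i ↑ˡ n) (j ↑ˡ n) (D_P C π) (X ++ Y) W ⇔
        ((∃[ X' ] (N i j (asSet (C k)) X X' × W ≡ X' ++ Y)) ⊎
         (∃[ Z ] (Z ∈C C (Inverse.to π l) × dist Z Y ≡ 2 × W ≡ addUnit j (addUnit i X) ++ Z))))
mainTheorem2 n _ L C (_ , oddWeight , _ , disjoint) π X Y XY∈D_P k X∈Cₖ i j i≢j l X⁺∈Cₗ W = mk⇔ N-⊆ N-⊇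
  where
  open Neighbourhood C π oddWeight disjoint X∈Cₖ (∈D_P⇒∈C disjoint π XY∈D_P X∈Cₖ) i≢j X⁺∈Cₗ
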